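{- (1) Let $j\ge 4$. Then $\{G_j^{(r)}\}_{r=1}^{\infty}$ is a strictly increasing sequence. (2) Let $r\ge 1$. Then $\{G_j^{(r)}\}_{j=2}^{\infty}$ is a strictly increasing sequence. (3) Let $j\ge 4$. Then $\{H_j^{(r)}\}_{r=1}^{\infty}$ is a strictly increasing sequence. (4) Let $r\ge 1$. Then $\{H_j^{(r)}\}_{j=2}^{\infty}$ is a strictly increasing sequence.
   Context: For a positive integer $r$, the convolved Fibonacci numbers $F_{j+1}^{(r)}$ ($j\ge0$) are defined by $(1-z-z^2)^{ -r}=\sum_{j\ge 0}F_{j+1}^{(r)}z^j$. With $\mu$ the Möbius function, define for integers $r\ge1$, $j\ge0$: $G_{j+1}^{(r)}=\frac1r\sum_{d\mid\gcd(r,j)}\mu(d)F_{j/d+1}^{(r/d)}$ and $H_{j+1}^{(r)}=\frac{(-1)^r}{r}\sum_{d\mid\gcd(r,j)}\mu(d)(-1)^{r/d}F_{j/d+1}^{(r/d)}$ (for $j=0$, $d$ ranges over divisors of $r$). Equivalently, $G_{j+1}^{(r)}$ is the coefficient of $z^j$ in $\frac1r\sum_{d\mid r}\mu(d)f(z^d)^{r/d}$ with $f=1/(1-z-z^2)$, and $H_{j+1}^{(r)}$ is $(-1)^r$ times this coefficient with $f=-1/(1-z-z^2)$. -}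

module Defs where

open import Data.Nat as ℕ using (ℕ; zero; suc; _∸_; NonZero)
open import Data.Nat.DivMod using (_/_)
open import Data.Nat.Divisibility using (_∣?_)
open import Data.Nat.GCD using (gcd)
open import Data.Nat.Primality using (prime?)
open import Data.Integer as ℤ using (ℤ; +_; -1ℤ; 0ℤ; 1ℤ)
open import Data.List using (List; []; _∷_; upTo; filter; length; map; foldr)
open import Data.Bool.ListAction using (any)
open import Data.Bool using (Bool; if_then_else_)
open import Data.Product using (_,_)
open import Relation.Nullary.Decidable using (_×-dec_; ⌊_⌋)
open import Data.Rational as ℚ using (ℚ)

fib : ℕ → ℕ
fib zero = 0
fib (suc zero) = 1
fib (suc (suc n)) = fib n ℕ.+ fib (suc n)

sumTo : ℕ → (ℕ → ℕ) → ℕ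
sumTo zero f = f 0
sumTo (suc j) f = sumTo j f ℕ.+ f (suc j)

-- coef r j = coefficient of z^j in (1 - z - z²)^(-r) = (Σ_i fib(i+1) z^i)^r,
-- i.e. coef r j = F_{j+1}^{(r)}.  Computed as the r-fold Cauchy power.
coef : ℕ → ℕ → ℕ
coef zero zero = 1
coef zero (suc j) = 0
coef (suc r) j = sumTo j (λ i → fib (suc i) ℕ.* coef r (j ∸ i))

F : ℕ → ℕ → ℕ
F r n = coef r (n ∸ 1)

ω : ℕ → ℕ
ω n = length (filter (λ p → prime? p ×-dec (p ∣? n)) (upTo (suc n)))

hasSquareFactor : ℕ → Bool
hasSquareFactor n = any (λ k → ⌊ (suc (suc k) ℕ.* suc (suc k)) ∣? n ⌋) (upTo n)

μ : ℕ → ℤ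
μ n = if hasSquareFactor n then 0ℤ else (-1ℤ ℤ.^ ω n)

divSum : ℕ → ((d : ℕ) → .{{NonZero d}} → ℤ) → ℤ
divSum m f = foldr ℤ._+_ 0ℤ (map (λ k → if ⌊ suc k ∣? m ⌋ then f (suc k) else 0ℤ) (upTo m))

G : ℕ → ℕ → ℚ
G zero n = ℚ.0ℚ
G r@(suc _) n = divSum (gcd r (n ∸ 1)) (λ d → μ d ℤ.* (+ F (r / d) ((n ∸ 1) / d ℕ.+ 1))) ℚ./ r

H : ℕ → ℕ → ℚ
H zero n = ℚ.0ℚ
H r@(suc _) n = ((-1ℤ ℤ.^ r) ℤ.* divSum (gcd r (n ∸ 1))
  (λ d → μ d ℤ.* ((-1ℤ ℤ.^ (r / d)) ℤ.* (+ F (r / d) ((n ∸ 1) / d ℕ.+ 1))))) ℚ./ r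

-- Write c r j for coef r j = F^{(r)}_{j+1}. In r·G^{(r)}_{j+1} = Σ_{d ∣ gcd(r,j)} μ(d) c (r/d) (j/d) the
-- term d = 1 is c r j, and each of the at most j − 1 other terms is bounded by c ⌊r/2⌋ ⌊j/2⌋; up to the
-- sign (-1)^r the same holds for r·H^{(r)}_{j+1}. Both monotonicity statements therefore reduce to
-- inequalities between convolved Fibonacci numbers that beat this error term.
-- These follow from supermultiplicativity c a k · c b l ≤ c (a+b) (k+l), the derivative identity
-- j c (r+1) j = (r+1) Σ_i i F_{i+1} c r (j−i) and the recurrence c (s+1) (t+2) = c s (t+2) + c (s+1) (t+1)
-- + c (s+1) t, as soon as r is large compared with j or j ≥ 20, where Fibonacci growth takes over. The
-- finitely many remaining cases, r ≤ 76 and j ≤ 19, are checked by evaluating a table of the c r j.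

module Submission where

open import Defs
open import Data.Nat
open import Data.Nat.Properties
open import Data.Nat.DivMod using (_/_; n/1≡n; /-monoʳ-≤; m/n≡1+[m∸n]/n)
open import Data.Nat.Divisibility using (_∣?_; ∣⇒≤; 1∣_)
open import Data.Nat.GCD using (gcd; gcd[m,n]∣m; gcd[m,n]∣n; gcd[m,n]≢0)
open import Data.Nat.Tactic.RingSolver using (solve-∀)
open import Algebra.Properties.CommutativeSemigroup *-commutativeSemigroup using ()
  renaming (x∙yz≈y∙xz to *-left-comm)
open import Algebra.Properties.CommutativeSemigroup +-commutativeSemigroup using ()
  renaming (interchange to +-interchange; xy∙z≈xz∙y to +-right-comm; x∙yz≈yx∙z to x+[y+z]≡y+x+z)
open import Data.Integer as ℤ using (ℤ; +_; -[1+_]; ∣_∣; +≤+; -≤+; 0ℤ; -1ℤ)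
import Data.Integer.Properties as ℤ
import Data.Integer.Tactic.RingSolver as ℤ-Solver
open import Data.Rational as ℚ using (ℚ)
import Data.Rational.Properties as ℚ
import Data.Rational.Unnormalised as ℚᵘ
import Data.Rational.Unnormalised.Properties as ℚᵘ
open import Data.Bool using (Bool; true; false; T; _∧_; if_then_else_)
open import Data.Bool.Properties using (T-∧)
open import Data.Bool.ListAction using (all)
open import Data.List using (List; []; _∷_; map; foldr; length; upTo; applyUpTo; iterate)
open import Data.List.Properties using (length-map; length-applyUpTo)
open import Data.List.Relation.Unary.All using (All; []; _∷_)
open import Data.List.Relation.Unary.All.Properties using (all⁺; applyUpTo⁻; map⁺; applyUpTo⁺₁)
open import Data.Product using (Σ-syntax; _×_; _,_; proj₁; proj₂)
open import Data.Sum using (inj₁; inj₂)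
open import Data.Unit using (tt)
open import Function using (_∘_; id; Equivalence)
open import Relation.Nullary.Decidable using (Dec; yes; no; ⌊_⌋; isYes; isYes≗does; dec-true; toWitness)
open import Relation.Binary.PropositionalEquality

-- Finite sums and Cauchy products

mono-≤-by-step : ∀ (f : ℕ → ℕ) {m n} → (∀ k → m ≤ k → f k ≤ f (suc k)) → m ≤ n → f m ≤ f n
mono-≤-by-step f {m} {n} step m≤n with m≤n⇒m<n∨m≡n m≤n
... | inj₂ refl = ≤-refl
mono-≤-by-step f {m} {suc n} step _ | inj₁ (s≤s m≤n) =
  ≤-trans (mono-≤-by-step f step m≤n) (step n m≤n)

sumTo-cong : ∀ j {g h : ℕ → ℕ} → (∀ i → i ≤ j → g i ≡ h i) → sumTo j g ≡ sumTo j h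
sumTo-cong zero g≡h = g≡h 0 z≤n
sumTo-cong (suc j) g≡h =
  cong₂ _+_ (sumTo-cong j (λ i i≤j → g≡h i (m≤n⇒m≤1+n i≤j))) (g≡h (suc j) ≤-refl)

sumTo-mono-≤ : ∀ j {g h : ℕ → ℕ} → (∀ i → i ≤ j → g i ≤ h i) → sumTo j g ≤ sumTo j h
sumTo-mono-≤ zero g≤h = g≤h 0 z≤n
sumTo-mono-≤ (suc j) g≤h =
  +-mono-≤ (sumTo-mono-≤ j (λ i i≤j → g≤h i (m≤n⇒m≤1+n i≤j))) (g≤h (suc j) ≤-refl)

sumTo-distrib-+ : ∀ j (g h : ℕ → ℕ) → sumTo j (λ i → g i + h i) ≡ sumTo j g + sumTo j h
sumTo-distrib-+ zero g h = refl
sumTo-distrib-+ (suc j) g h rewrite sumTo-distrib-+ j g h =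
  +-interchange (sumTo j g) (sumTo j h) (g (suc j)) (h (suc j))

*-distribˡ-sumTo : ∀ j k (g : ℕ → ℕ) → k * sumTo j g ≡ sumTo j (λ i → k * g i)
*-distribˡ-sumTo zero k g = refl
*-distribˡ-sumTo (suc j) k g rewrite sym (*-distribˡ-sumTo j k g) =
  *-distribˡ-+ k (sumTo j g) (g (suc j))

sumTo-suc : ∀ j (g : ℕ → ℕ) → sumTo (suc j) g ≡ g 0 + sumTo j (λ i → g (suc i))
sumTo-suc zero g = refl
sumTo-suc (suc j) g rewrite sumTo-suc j g = +-assoc (g 0) _ _

sumTo-zero : ∀ j (g : ℕ → ℕ) → (∀ i → i ≤ j → g i ≡ 0) → sumTo j g ≡ 0
sumTo-zero zero g g≡0 = g≡0 0 z≤n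
sumTo-zero (suc j) g g≡0 =
  cong₂ _+_ (sumTo-zero j g (λ i i≤j → g≡0 i (m≤n⇒m≤1+n i≤j))) (g≡0 (suc j) ≤-refl)

term≤sumTo : ∀ j (g : ℕ → ℕ) {i} → i ≤ j → g i ≤ sumTo j g
term≤sumTo zero g z≤n = ≤-refl
term≤sumTo (suc j) g i≤1+j with m≤n⇒m<n∨m≡n i≤1+j
... | inj₁ (s≤s i≤j) = ≤-trans (term≤sumTo j g i≤j) (m≤m+n _ _)
... | inj₂ refl = m≤n+m _ _

sumTo-monoˡ-≤ : ∀ (g : ℕ → ℕ) {j k} → j ≤ k → sumTo j g ≤ sumTo k g
sumTo-monoˡ-≤ g = mono-≤-by-step (λ k → sumTo k g) (λ k _ → m≤m+n _ _)

sumTo-reverse : ∀ j (g : ℕ → ℕ) → sumTo j g ≡ sumTo j (λ i → g (j ∸ i))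
sumTo-reverse zero g = refl
sumTo-reverse (suc j) g = begin
  sumTo (suc j) g                               ≡⟨ sumTo-suc j g ⟩
  g 0 + sumTo j (λ i → g (suc i))               ≡⟨ cong (_+_ (g 0)) (sumTo-reverse j (λ i → g (suc i))) ⟩
  g 0 + sumTo j (λ i → g (suc (j ∸ i)))         ≡⟨ +-comm (g 0) _ ⟩
  sumTo j (λ i → g (suc (j ∸ i))) + g 0
    ≡⟨ cong₂ _+_ (sumTo-cong j (λ i i≤j → cong g (sym (+-∸-assoc 1 i≤j))))
                 (cong g (sym (n∸n≡0 j))) ⟩
  sumTo (suc j) (λ i → g (suc j ∸ i))           ∎
  where open ≡-Reasoning

sumTo-triangle-suc : ∀ n (g : ℕ → ℕ → ℕ) →
  sumTo (suc n) (λ i → sumTo (suc n ∸ i) (g i)) ≡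
  sumTo n (λ i → sumTo (n ∸ i) (g i)) + sumTo (suc n) (λ i → g i (suc n ∸ i))
sumTo-triangle-suc n g = begin
  sumTo n (λ i → sumTo (suc n ∸ i) (g i)) + sumTo (n ∸ n) (g (suc n))
    ≡⟨ cong₂ _+_ (sumTo-cong n (λ i i≤n → cong (λ k → sumTo k (g i)) (+-∸-assoc 1 i≤n)))
                 (cong (λ k → sumTo k (g (suc n))) (n∸n≡0 n)) ⟩
  sumTo n (λ i → sumTo (n ∸ i) (g i) + g i (suc (n ∸ i))) + g (suc n) 0
    ≡⟨ cong (_+ g (suc n) 0) (sumTo-distrib-+ n _ _) ⟩
  (Tₙ + sumTo n (λ i → g i (suc (n ∸ i)))) + g (suc n) 0
    ≡⟨ +-assoc Tₙ _ _ ⟩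
  Tₙ + (sumTo n (λ i → g i (suc (n ∸ i))) + g (suc n) 0)
    ≡⟨ cong (_+_ Tₙ) (cong₂ _+_ (sumTo-cong n (λ i i≤n → cong (g i) (sym (+-∸-assoc 1 i≤n))))
                               (cong (g (suc n)) (sym (n∸n≡0 n)))) ⟩
  Tₙ + sumTo (suc n) (λ i → g i (suc n ∸ i)) ∎
  where
  open ≡-Reasoning
  Tₙ = sumTo n (λ i → sumTo (n ∸ i) (g i))

sumTo-triangle-swap : ∀ n (g : ℕ → ℕ → ℕ) →
  sumTo n (λ i → sumTo (n ∸ i) (g i)) ≡ sumTo n (λ l → sumTo (n ∸ l) (λ i → g i l))
sumTo-triangle-swap zero g = refl
sumTo-triangle-swap (suc n) g = begin
  sumTo (suc n) (λ i → sumTo (suc n ∸ i) (g i))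
    ≡⟨ sumTo-triangle-suc n g ⟩
  sumTo n (λ i → sumTo (n ∸ i) (g i)) + sumTo (suc n) (λ i → g i (suc n ∸ i))
    ≡⟨ cong₂ _+_ (sumTo-triangle-swap n g) (sumTo-reverse (suc n) (λ i → g i (suc n ∸ i))) ⟩
  sumTo n (λ l → sumTo (n ∸ l) (λ i → g i l)) + sumTo (suc n) (λ l → g (suc n ∸ l) (suc n ∸ (suc n ∸ l)))
    ≡⟨ cong (_+_ (sumTo n (λ l → sumTo (n ∸ l) (λ i → g i l)))) (sumTo-cong (suc n) (λ l l≤ → cong (g (suc n ∸ l)) (m∸[m∸n]≡n l≤))) ⟩
  sumTo n (λ l → sumTo (n ∸ l) (λ i → g i l)) + sumTo (suc n) (λ l → g (suc n ∸ l) l)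
    ≡⟨ sumTo-triangle-suc n (λ l i → g i l) ⟨
  sumTo (suc n) (λ l → sumTo (suc n ∸ l) (λ i → g i l)) ∎
  where open ≡-Reasoning

infixl 7 _⋆_

_⋆_ : (ℕ → ℕ) → (ℕ → ℕ) → ℕ → ℕ
(a ⋆ b) n = sumTo n (λ i → a i * b (n ∸ i))

⋆-identityʳ : ∀ (a : ℕ → ℕ) n → (a ⋆ coef 0) n ≡ a n
⋆-identityʳ a zero = *-identityʳ (a 0)
⋆-identityʳ a (suc n) = begin
  sumTo n (λ i → a i * coef 0 (suc n ∸ i)) + a (suc n) * coef 0 (n ∸ n)
    ≡⟨ cong₂ _+_ (sumTo-zero n _ (λ i i≤n → trans (cong (λ k → a i * coef 0 k) (+-∸-assoc 1 i≤n))
                                                    (*-zeroʳ (a i))))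
                 (cong (λ k → a (suc n) * coef 0 k) (n∸n≡0 n)) ⟩
  a (suc n) * 1
    ≡⟨ *-identityʳ (a (suc n)) ⟩
  a (suc n) ∎
  where open ≡-Reasoning

⋆-left-comm : ∀ (a b c : ℕ → ℕ) n → (a ⋆ (b ⋆ c)) n ≡ (b ⋆ (a ⋆ c)) n
⋆-left-comm a b c n = begin
  sumTo n (λ i → a i * sumTo (n ∸ i) (λ l → b l * c (n ∸ i ∸ l)))
    ≡⟨ sumTo-cong n (λ i _ → *-distribˡ-sumTo (n ∸ i) (a i) _) ⟩
  sumTo n (λ i → sumTo (n ∸ i) (λ l → a i * (b l * c (n ∸ i ∸ l))))
    ≡⟨ sumTo-triangle-swap n (λ i l → a i * (b l * c (n ∸ i ∸ l))) ⟩
  sumTo n (λ l → sumTo (n ∸ l) (λ i → a i * (b l * c (n ∸ i ∸ l))))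
    ≡⟨ sumTo-cong n (λ l _ → sumTo-cong (n ∸ l) (λ i _ →
         trans (cong (λ k → a i * (b l * c k)) (∸-comm n i l)) (*-left-comm (a i) (b l) _))) ⟩
  sumTo n (λ l → sumTo (n ∸ l) (λ i → b l * (a i * c (n ∸ l ∸ i))))
    ≡⟨ sumTo-cong n (λ l _ → *-distribˡ-sumTo (n ∸ l) (b l) _) ⟨
  sumTo n (λ l → b l * sumTo (n ∸ l) (λ i → a i * c (n ∸ l ∸ i))) ∎
  where
  open ≡-Reasoning
  ∸-comm : ∀ n i l → n ∸ i ∸ l ≡ n ∸ l ∸ i
  ∸-comm n i l = trans (∸-+-assoc n i l) (trans (cong (n ∸_) (+-comm i l)) (sym (∸-+-assoc n l i)))

∂ : (ℕ → ℕ) → ℕ → ℕ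
∂ a i = i * a i

∂-⋆ : ∀ (a b : ℕ → ℕ) n → ∂ (a ⋆ b) n ≡ (∂ a ⋆ b) n + (a ⋆ ∂ b) n
∂-⋆ a b n = begin
  n * sumTo n (λ i → a i * b (n ∸ i))
    ≡⟨ *-distribˡ-sumTo n n _ ⟩
  sumTo n (λ i → n * (a i * b (n ∸ i)))
    ≡⟨ sumTo-cong n (λ i i≤n → trans (cong (λ k → k * (a i * b (n ∸ i))) (sym (m+[n∸m]≡n i≤n)))
                                     (leibniz i (n ∸ i) (a i) (b (n ∸ i)))) ⟩
  sumTo n (λ i → i * a i * b (n ∸ i) + a i * ((n ∸ i) * b (n ∸ i)))
    ≡⟨ sumTo-distrib-+ n _ _ ⟩
  (∂ a ⋆ b) n + (a ⋆ ∂ b) n ∎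
  where
  open ≡-Reasoning
  leibniz : ∀ i k x y → (i + k) * (x * y) ≡ i * x * y + x * (k * y)
  leibniz = solve-∀

-- Convolved Fibonacci numbers

fib⁺ : ℕ → ℕ
fib⁺ i = fib (suc i)

fib-mono-≤ : ∀ {m n} → m ≤ n → fib m ≤ fib n
fib-mono-≤ = mono-≤-by-step fib (λ k _ → fib≤fib-suc k)
  where
  fib≤fib-suc : ∀ n → fib n ≤ fib (suc n)
  fib≤fib-suc zero = z≤n
  fib≤fib-suc (suc zero) = ≤-refl
  fib≤fib-suc (suc (suc n)) = m≤n+m (fib (suc (suc n))) (fib (suc n))

coef-one : ∀ j → coef 1 j ≡ fib (suc j)
coef-one = ⋆-identityʳ fib⁺

coef-at-0 : ∀ r → coef r 0 ≡ 1
coef-at-0 zero = refl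
coef-at-0 (suc r) rewrite coef-at-0 r = refl

coef-at-1 : ∀ r → coef r 1 ≡ r
coef-at-1 zero = refl
coef-at-1 (suc r) rewrite coef-at-1 r | coef-at-0 r =
  trans (+-comm (r + 0) 1) (cong suc (+-identityʳ r))

-- z (f ^ (r+1))′ = (r+1) · z f′ · f ^ r, coefficientwise, for f = 1 / (1 − z − z²).
∂-coef : ∀ r j → ∂ (coef (suc r)) j ≡ suc r * (∂ fib⁺ ⋆ coef r) j
∂-coef zero j = begin
  j * (fib⁺ ⋆ coef 0) j     ≡⟨ cong (j *_) (⋆-identityʳ fib⁺ j) ⟩
  ∂ fib⁺ j                  ≡⟨ ⋆-identityʳ (∂ fib⁺) j ⟨
  (∂ fib⁺ ⋆ coef 0) j       ≡⟨ *-identityˡ _ ⟨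
  1 * (∂ fib⁺ ⋆ coef 0) j   ∎
  where open ≡-Reasoning
∂-coef (suc r) j = begin
  ∂ (fib⁺ ⋆ coef (suc r)) j
    ≡⟨ ∂-⋆ fib⁺ (coef (suc r)) j ⟩
  V + (fib⁺ ⋆ ∂ (coef (suc r))) j
    ≡⟨ cong (_+_ V) (sumTo-cong j (λ i _ → trans (cong (fib⁺ i *_) (∂-coef r (j ∸ i)))
                                                (*-left-comm (fib⁺ i) (suc r) _))) ⟩
  V + sumTo j (λ i → suc r * (fib⁺ i * (∂ fib⁺ ⋆ coef r) (j ∸ i)))
    ≡⟨ cong (_+_ V) (*-distribˡ-sumTo j (suc r) _) ⟨
  V + suc r * (fib⁺ ⋆ (∂ fib⁺ ⋆ coef r)) j
    ≡⟨ cong (λ x → V + suc r * x) (⋆-left-comm fib⁺ (∂ fib⁺) (coef r) j) ⟩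
  V + suc r * V ∎
  where
  open ≡-Reasoning
  V = (∂ fib⁺ ⋆ coef (suc r)) j

coef-supermultiplicative : ∀ a b k l → coef a k * coef b l ≤ coef (a + b) (k + l)
coef-supermultiplicative a zero k zero
  rewrite +-identityʳ a | +-identityʳ k | *-identityʳ (coef a k) = ≤-refl
coef-supermultiplicative a zero k (suc l) rewrite *-zeroʳ (coef a k) = z≤n
coef-supermultiplicative a (suc b) k l = begin
  coef a k * sumTo l (λ i → fib⁺ i * coef b (l ∸ i))
    ≡⟨ *-distribˡ-sumTo l (coef a k) _ ⟩
  sumTo l (λ i → coef a k * (fib⁺ i * coef b (l ∸ i)))
    ≤⟨ sumTo-mono-≤ l termwise ⟩
  sumTo l (λ i → fib⁺ i * coef (a + b) (k + l ∸ i))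
    ≤⟨ sumTo-monoˡ-≤ _ (m≤n+m l k) ⟩
  coef (suc (a + b)) (k + l)
    ≡⟨ cong (λ x → coef x (k + l)) (+-suc a b) ⟨
  coef (a + suc b) (k + l) ∎
  where
  open ≤-Reasoning
  termwise : ∀ i → i ≤ l → coef a k * (fib⁺ i * coef b (l ∸ i)) ≤ fib⁺ i * coef (a + b) (k + l ∸ i)
  termwise i i≤l = begin
    coef a k * (fib⁺ i * coef b (l ∸ i))   ≡⟨ *-left-comm (coef a k) (fib⁺ i) _ ⟩
    fib⁺ i * (coef a k * coef b (l ∸ i))   ≤⟨ *-monoʳ-≤ (fib⁺ i) (coef-supermultiplicative a b k (l ∸ i)) ⟩
    fib⁺ i * coef (a + b) (k + (l ∸ i))    ≡⟨ cong (λ x → fib⁺ i * coef (a + b) x) (+-∸-assoc k i≤l) ⟨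
    fib⁺ i * coef (a + b) (k + l ∸ i)      ∎

coef-monoˡ-≤ : ∀ j {r r′} → r ≤ r′ → coef r j ≤ coef r′ j
coef-monoˡ-≤ j = mono-≤-by-step (λ r → coef r j) (λ r _ → coef≤coef-suc r)
  where
  coef≤coef-suc : ∀ r → coef r j ≤ coef (suc r) j
  coef≤coef-suc r = subst₂ (λ x y → x ≤ coef y j) (*-identityʳ (coef r j)) (+-comm r 1)
    (subst (λ y → coef r j * 1 ≤ coef (r + 1) y) (+-identityʳ j)
      (coef-supermultiplicative r 1 j 0))

coef-monoʳ-≤ : ∀ r {j j′} → j ≤ j′ → coef (suc r) j ≤ coef (suc r) j′
coef-monoʳ-≤ r = mono-≤-by-step (coef (suc r)) (λ j _ → coef≤coef-suc j)
  where
  coef≤coef-suc : ∀ j → coef (suc r) j ≤ coef (suc r) (suc j)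
  coef≤coef-suc j = begin
    sumTo j (λ i → fib⁺ i * coef r (j ∸ i))
      ≤⟨ sumTo-mono-≤ j (λ i _ → *-monoˡ-≤ (coef r (j ∸ i)) (fib-mono-≤ (n≤1+n (suc i)))) ⟩
    sumTo j (λ i → fib⁺ (suc i) * coef r (j ∸ i))
      ≤⟨ m≤n+m _ _ ⟩
    fib⁺ 0 * coef r (suc j) + sumTo j (λ i → fib⁺ (suc i) * coef r (j ∸ i))
      ≡⟨ sumTo-suc j (λ i → fib⁺ i * coef r (suc j ∸ i)) ⟨
    coef (suc r) (suc j) ∎
    where open ≤-Reasoning

coef-positive : ∀ r j → 1 ≤ coef (suc r) j
coef-positive r j = subst (_≤ coef (suc r) j) (coef-at-0 (suc r)) (coef-monoʳ-≤ r {0} {j} z≤n)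

r≤coef : ∀ r {m} → 1 ≤ m → r ≤ coef r m
r≤coef zero _ = z≤n
r≤coef (suc r) {m} 1≤m = subst (_≤ coef (suc r) m) (coef-at-1 (suc r)) (coef-monoʳ-≤ r 1≤m)

fib≤coef : ∀ r m → 1 ≤ r → fib (suc m) ≤ coef r m
fib≤coef r m 1≤r = subst (_≤ coef r m) (coef-one m) (coef-monoˡ-≤ m 1≤r)

coef-suc-suc : ∀ s t → coef (suc s) (suc t) ≡ coef s (suc t) + (fib⁺ ∘ suc ⋆ coef s) t
coef-suc-suc s t = trans (sumTo-suc t (λ i → fib⁺ i * coef s (suc t ∸ i)))
                         (cong (_+ (fib⁺ ∘ suc ⋆ coef s) t) (+-identityʳ (coef s (suc t))))

-- (1 − z − z²) · f ^ (s+1) = f ^ s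
coef-recurrence : ∀ s t →
  coef (suc s) (2 + t) ≡ coef s (2 + t) + coef (suc s) (1 + t) + coef (suc s) t
coef-recurrence s t = begin
  coef (suc s) (2 + t)
    ≡⟨ coef-suc-suc s (suc t) ⟩
  coef s (2 + t) + (fib⁺ ∘ suc ⋆ coef s) (suc t)
    ≡⟨ cong (_+_ (coef s (2 + t))) shifted-suc ⟩
  coef s (2 + t) + (coef s (suc t) + coef (suc s) t + (fib⁺ ∘ suc ⋆ coef s) t)
    ≡⟨ a+[b+c+d]≡a+[b+d]+c (coef s (2 + t)) (coef s (1 + t)) (coef (suc s) t) _ ⟩
  coef s (2 + t) + (coef s (suc t) + (fib⁺ ∘ suc ⋆ coef s) t) + coef (suc s) t
    ≡⟨ cong (λ x → coef s (2 + t) + x + coef (suc s) t) (coef-suc-suc s t) ⟨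
  coef s (2 + t) + coef (suc s) (1 + t) + coef (suc s) t ∎
  where
  open ≡-Reasoning
  shifted-suc : (fib⁺ ∘ suc ⋆ coef s) (suc t)
              ≡ coef s (suc t) + coef (suc s) t + (fib⁺ ∘ suc ⋆ coef s) t
  shifted-suc = begin
    (fib⁺ ∘ suc ⋆ coef s) (suc t)
      ≡⟨ sumTo-suc t (λ i → fib⁺ (suc i) * coef s (suc t ∸ i)) ⟩
    1 * coef s (suc t) + sumTo t (λ i → (fib⁺ i + fib⁺ (suc i)) * coef s (t ∸ i))
      ≡⟨ cong₂ _+_ (*-identityˡ (coef s (suc t)))
                   (trans (sumTo-cong t (λ i _ → *-distribʳ-+ (coef s (t ∸ i)) (fib⁺ i) (fib⁺ (suc i))))
                          (sumTo-distrib-+ t _ _)) ⟩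
    coef s (suc t) + (coef (suc s) t + (fib⁺ ∘ suc ⋆ coef s) t)
      ≡⟨ +-assoc (coef s (suc t)) _ _ ⟨
    coef s (suc t) + coef (suc s) t + (fib⁺ ∘ suc ⋆ coef s) t ∎
  a+[b+c+d]≡a+[b+d]+c : ∀ a b c d → a + (b + c + d) ≡ a + (b + d) + c
  a+[b+c+d]≡a+[b+d]+c = solve-∀

coef-step : ∀ s t → coef s (suc t) + coef s t ≤ coef (suc s) (suc t)
coef-step s t = begin
  coef s (suc t) + coef s t
    ≤⟨ +-monoʳ-≤ (coef s (suc t)) (subst (_≤ (fib⁺ ∘ suc ⋆ coef s) t) (+-identityʳ (coef s t))
                                        (term≤sumTo t (λ i → fib⁺ (suc i) * coef s (t ∸ i)) z≤n)) ⟩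
  coef s (suc t) + (fib⁺ ∘ suc ⋆ coef s) t
    ≡⟨ coef-suc-suc s t ⟨
  coef (suc s) (suc t) ∎
  where open ≤-Reasoning

⋆-coef-step : ∀ (a : ℕ → ℕ) s t → (a ⋆ coef s) (suc t) + (a ⋆ coef s) t ≤ (a ⋆ coef (suc s)) (suc t)
⋆-coef-step a s t = begin
  (sumTo t (λ i → a i * coef s (suc t ∸ i)) + a (suc t) * coef s (t ∸ t)) + sumTo t (λ i → a i * coef s (t ∸ i))
    ≡⟨ +-right-comm (sumTo t _) _ _ ⟩
  (sumTo t (λ i → a i * coef s (suc t ∸ i)) + sumTo t (λ i → a i * coef s (t ∸ i))) + a (suc t) * coef s (t ∸ t)
    ≡⟨ cong (_+ a (suc t) * coef s (t ∸ t)) (sumTo-distrib-+ t _ _) ⟨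
  sumTo t (λ i → a i * coef s (suc t ∸ i) + a i * coef s (t ∸ i)) + a (suc t) * coef s (t ∸ t)
    ≤⟨ +-mono-≤ (sumTo-mono-≤ t termwise) (*-monoʳ-≤ (a (suc t)) (coef-monoˡ-≤ (t ∸ t) (n≤1+n s))) ⟩
  sumTo t (λ i → a i * coef (suc s) (suc t ∸ i)) + a (suc t) * coef (suc s) (t ∸ t) ∎
  where
  open ≤-Reasoning
  termwise : ∀ i → i ≤ t → a i * coef s (suc t ∸ i) + a i * coef s (t ∸ i) ≤ a i * coef (suc s) (suc t ∸ i)
  termwise i i≤t rewrite +-∸-assoc 1 i≤t =
    subst (_≤ a i * coef (suc s) (suc (t ∸ i))) (*-distribˡ-+ (a i) (coef s (suc (t ∸ i))) _)
          (*-monoʳ-≤ (a i) (coef-step s (t ∸ i)))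

⌈n/2⌉≤1+⌊n/2⌋ : ∀ n → ⌈ n /2⌉ ≤ suc ⌊ n /2⌋
⌈n/2⌉≤1+⌊n/2⌋ zero = z≤n
⌈n/2⌉≤1+⌊n/2⌋ (suc zero) = s≤s z≤n
⌈n/2⌉≤1+⌊n/2⌋ (suc (suc n)) = s≤s (⌈n/2⌉≤1+⌊n/2⌋ n)

n≤⌊n/2⌋+1+⌊n/2⌋ : ∀ n → n ≤ ⌊ n /2⌋ + suc ⌊ n /2⌋
n≤⌊n/2⌋+1+⌊n/2⌋ n = subst (_≤ ⌊ n /2⌋ + suc ⌊ n /2⌋) (⌊n/2⌋+⌈n/2⌉≡n n)
                            (+-monoʳ-≤ ⌊ n /2⌋ (⌈n/2⌉≤1+⌊n/2⌋ n))

fib⁺-supermultiplicative : ∀ a b → fib (suc a) * fib (suc b) ≤ fib (suc (a + b))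
fib⁺-supermultiplicative zero b = ≤-reflexive (+-identityʳ (fib (suc b)))
fib⁺-supermultiplicative (suc zero) b =
  ≤-trans (≤-reflexive (+-identityʳ (fib (suc b)))) (fib-mono-≤ (n≤1+n (suc b)))
fib⁺-supermultiplicative (suc (suc a)) b = begin
  (fib (suc a) + fib (suc (suc a))) * fib (suc b)
    ≡⟨ *-distribʳ-+ (fib (suc b)) (fib (suc a)) (fib (suc (suc a))) ⟩
  fib (suc a) * fib (suc b) + fib (suc (suc a)) * fib (suc b)
    ≤⟨ +-mono-≤ (fib⁺-supermultiplicative a b) (fib⁺-supermultiplicative (suc a) b) ⟩
  fib (suc (a + b)) + fib (suc (suc (a + b))) ∎
  where open ≤-Reasoning

fib-linear-bound : ∀ k → 10 ≤ k → 4 * k + 2 ≤ fib k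
fib-linear-bound k 10≤k = subst (λ n → 4 * n + 2 ≤ fib n) (m∸n+n≡m 10≤k) (from-10 (k ∸ 10))
  where
  from-10 : ∀ n → 4 * (n + 10) + 2 ≤ fib (n + 10)
  from-10 zero = ≤ᵇ⇒≤ 42 55 _
  from-10 (suc zero) = ≤ᵇ⇒≤ 46 89 _
  from-10 (suc (suc n)) = ≤-trans step (+-mono-≤ (from-10 n) (from-10 (suc n)))
    where
    surplus : ∀ n → 4 * (n + 10) + 2 + (4 * (suc n + 10) + 2) ≡ 4 * (suc (suc n) + 10) + 2 + (4 * n + 38)
    surplus = solve-∀
    step : 4 * (suc (suc n) + 10) + 2 ≤ 4 * (n + 10) + 2 + (4 * (suc n + 10) + 2)
    step = subst (4 * (suc (suc n) + 10) + 2 ≤_) (sym (surplus n)) (m≤m+n _ (4 * n + 38))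

double≤fib-half : ∀ j → 20 ≤ j → 2 * j ≤ fib ⌊ j /2⌋
double≤fib-half j 20≤j = begin
  2 * j                                 ≤⟨ *-monoʳ-≤ 2 (n≤⌊n/2⌋+1+⌊n/2⌋ j) ⟩
  2 * (⌊ j /2⌋ + suc ⌊ j /2⌋)           ≡⟨ 2[h+1+h]≡4h+2 ⌊ j /2⌋ ⟩
  4 * ⌊ j /2⌋ + 2                       ≤⟨ fib-linear-bound ⌊ j /2⌋ (⌊n/2⌋-mono 20≤j) ⟩
  fib ⌊ j /2⌋                           ∎
  where
  open ≤-Reasoning
  2[h+1+h]≡4h+2 : ∀ h → 2 * (h + suc h) ≡ 4 * h + 2
  2[h+1+h]≡4h+2 = solve-∀

-- The gap inequalities

-- The numerator of G^{(r)}_{j+1} lies within errorBound r j of coef r j, so GapInR r j and GapInJ r j are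
-- what cross-multiplication needs for G to increase in r and in j. They are stated for an arbitrary array
-- c so that they can also be decided on a table of values.
module _ (c : ℕ → ℕ → ℕ) where

  errorBoundOf : ℕ → ℕ → ℕ
  errorBoundOf r j = (j ∸ 1) * c ⌊ r /2⌋ ⌊ j /2⌋

  GapInROf : ℕ → ℕ → Set
  GapInROf r j = suc r * (c r j + errorBoundOf r j) + r * errorBoundOf (suc r) j < r * c (suc r) j

  GapInJOf : ℕ → ℕ → Set
  GapInJOf r j = c r j + errorBoundOf r j + errorBoundOf r (suc j) < c r (suc j)

errorBound : ℕ → ℕ → ℕ
errorBound = errorBoundOf coef

GapInR GapInJ : ℕ → ℕ → Set
GapInR = GapInROf coef
GapInJ = GapInJOf coef

HalfBoundInR : ℕ → ℕ → Set
HalfBoundInR s t = 2 * suc t * coef ⌈ suc s /2⌉ ⌊ suc t /2⌋ ≤ coef (suc s) t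

HalfBoundInJ : ℕ → ℕ → Set
HalfBoundInJ s t = 2 * suc t * coef ⌊ 2 + s /2⌋ ⌈ suc t /2⌉ ≤ coef (suc s) (2 + t) + coef (2 + s) t

∂coef-step : ∀ s t →
  suc (suc s) * (∂ (coef (suc s)) (suc t) + ∂ (coef (suc s)) t) ≤ suc s * ∂ (coef (suc (suc s))) (suc t)
∂coef-step s t = begin
  suc r * (∂ (coef r) (suc t) + ∂ (coef r) t)
    ≡⟨ cong (suc r *_) (cong₂ _+_ (∂-coef s (suc t)) (∂-coef s t)) ⟩
  suc r * (r * V s (suc t) + r * V s t)
    ≡⟨ cong (suc r *_) (*-distribˡ-+ r (V s (suc t)) (V s t)) ⟨
  suc r * (r * (V s (suc t) + V s t))
    ≤⟨ *-monoʳ-≤ (suc r) (*-monoʳ-≤ r (⋆-coef-step (∂ fib⁺) s t)) ⟩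
  suc r * (r * V r (suc t))
    ≡⟨ *-left-comm (suc r) r (V r (suc t)) ⟩
  r * (suc r * V r (suc t))
    ≡⟨ cong (r *_) (∂-coef r (suc t)) ⟨
  r * ∂ (coef (suc r)) (suc t) ∎
  where
  open ≤-Reasoning
  r = suc s
  V : ℕ → ℕ → ℕ
  V s = ∂ fib⁺ ⋆ coef s

gapInR-from-halfBound : ∀ s t → 2 ≤ t → HalfBoundInR s t → GapInR (suc s) (suc t)
gapInR-from-halfBound s t 2≤t halfBound = *-cancelˡ-< j _ _ (begin-strict
  j * (suc r * (c + t * u) + r * (t * U))
    ≤⟨ *-monoʳ-≤ j (+-monoˡ-≤ (r * (t * U)) (*-monoʳ-≤ (suc r) (+-monoʳ-≤ c (*-monoʳ-≤ t u≤U)))) ⟩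
  j * (suc r * (c + t * U) + r * (t * U))
    ≡⟨ regroup j r t c U ⟩
  suc r * (j * c) + X * (2 * r + 1)
    <⟨ m<m+n _ X≥1 ⟩
  suc r * (j * c) + X * (2 * r + 1) + X
    ≡⟨ complete j r t c U ⟩
  suc r * (j * c + t * (2 * j * U))
    ≤⟨ *-monoʳ-≤ (suc r) (+-monoʳ-≤ (j * c) (*-monoʳ-≤ t halfBound)) ⟩
  suc r * (j * c + t * coef r t)
    ≤⟨ ∂coef-step s t ⟩
  r * (j * coef (suc r) j)
    ≡⟨ *-left-comm r j _ ⟩
  j * (r * coef (suc r) j) ∎)
  where
  open ≤-Reasoning
  r = suc s
  j = suc t
  c = coef r j
  u = coef ⌊ r /2⌋ ⌊ j /2⌋
  U = coef ⌈ r /2⌉ ⌊ j /2⌋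
  X = j * t * U
  u≤U : u ≤ U
  u≤U = coef-monoˡ-≤ ⌊ j /2⌋ (⌊n/2⌋≤⌈n/2⌉ r)
  X≥1 : 1 ≤ X
  X≥1 = *-mono-≤ {1} {j * t} (*-mono-≤ {1} {j} (s≤s z≤n) (≤-trans (s≤s z≤n) 2≤t))
                 (coef-positive ⌊ s /2⌋ ⌊ j /2⌋)
  regroup : ∀ j r t c U →
    j * (suc r * (c + t * U) + r * (t * U)) ≡ suc r * (j * c) + j * t * U * (2 * r + 1)
  regroup = solve-∀
  complete : ∀ j r t c U →
    suc r * (j * c) + j * t * U * (2 * r + 1) + j * t * U ≡ suc r * (j * c + t * (2 * j * U))
  complete = solve-∀

gapInJ-from-halfBound : ∀ s t → HalfBoundInJ s t → GapInJ (2 + s) (suc t)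
gapInJ-from-halfBound s t halfBound = begin-strict
  c + t * u + j * U
    ≤⟨ +-monoˡ-≤ (j * U) (+-monoʳ-≤ c (*-monoʳ-≤ t u≤U)) ⟩
  c + t * U + j * U
    <⟨ m<m+n _ (coef-positive ⌊ s /2⌋ ⌈ j /2⌉) ⟩
  c + t * U + j * U + U
    ≡⟨ complete c t U ⟩
  c + 2 * j * U
    ≤⟨ +-monoʳ-≤ c halfBound ⟩
  c + (coef (suc s) (suc j) + coef r t)
    ≡⟨ x+[y+z]≡y+x+z c (coef (suc s) (suc j)) (coef r t) ⟩
  coef (suc s) (suc j) + c + coef r t
    ≡⟨ coef-recurrence (suc s) t ⟨
  coef r (suc j) ∎
  where
  open ≤-Reasoning
  r = 2 + s
  j = suc t
  c = coef r j
  u = coef ⌊ r /2⌋ ⌊ j /2⌋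
  U = coef ⌊ r /2⌋ ⌈ j /2⌉
  u≤U : u ≤ U
  u≤U = coef-monoʳ-≤ ⌊ s /2⌋ (⌊n/2⌋≤⌈n/2⌉ j)
  complete : ∀ c t U → c + t * U + suc t * U + U ≡ c + 2 * suc t * U
  complete = solve-∀

n∸⌊n/2⌋≡⌈n/2⌉ : ∀ n → n ∸ ⌊ n /2⌋ ≡ ⌈ n /2⌉
n∸⌊n/2⌋≡⌈n/2⌉ n = trans (cong (_∸ ⌊ n /2⌋) (sym (⌊n/2⌋+⌈n/2⌉≡n n))) (m+n∸m≡n ⌊ n /2⌋ ⌈ n /2⌉)

n∸⌈n/2⌉≡⌊n/2⌋ : ∀ n → n ∸ ⌈ n /2⌉ ≡ ⌊ n /2⌋
n∸⌈n/2⌉≡⌊n/2⌋ n = trans (cong (_∸ ⌈ n /2⌉) (sym (⌊n/2⌋+⌈n/2⌉≡n n))) (m+n∸n≡m ⌊ n /2⌋ ⌈ n /2⌉)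

⌈n/2⌉+⌊n/2⌋≡n : ∀ n → ⌈ n /2⌉ + ⌊ n /2⌋ ≡ n
⌈n/2⌉+⌊n/2⌋≡n n = trans (+-comm ⌈ n /2⌉ ⌊ n /2⌋) (⌊n/2⌋+⌈n/2⌉≡n n)

⌊1+n/2⌋≤n : ∀ n → ⌊ suc n /2⌋ ≤ n
⌊1+n/2⌋≤n n = ≤-pred (⌊n/2⌋<n n)

⌊1+n/2⌋<n : ∀ {n} → 2 ≤ n → ⌊ suc n /2⌋ < n
⌊1+n/2⌋<n {suc zero} (s≤s ())
⌊1+n/2⌋<n {suc (suc n)} _ = s≤s (⌊n/2⌋<n n)

coef-split-bound : ∀ a b k l {r t} x → a + b ≡ r → k + l ≡ t → x ≤ coef b l → x * coef a k ≤ coef r t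
coef-split-bound a b k l x refl refl x≤ = begin
  x * coef a k          ≤⟨ *-monoˡ-≤ (coef a k) x≤ ⟩
  coef b l * coef a k   ≡⟨ *-comm (coef b l) (coef a k) ⟩
  coef a k * coef b l   ≤⟨ coef-supermultiplicative a b k l ⟩
  coef (a + b) (k + l)  ∎
  where open ≤-Reasoning

halfBoundInR-large-r : ∀ s t → 2 ≤ t → 2 * suc t ≤ ⌊ suc s /2⌋ → HalfBoundInR s t
halfBoundInR-large-r s t 2≤t 2j≤h =
  coef-split-bound ⌈ suc s /2⌉ ⌊ suc s /2⌋ ⌊ suc t /2⌋ (t ∸ ⌊ suc t /2⌋) (2 * suc t)
    (⌈n/2⌉+⌊n/2⌋≡n (suc s)) (m+[n∸m]≡n h≤t) (≤-trans 2j≤h (r≤coef ⌊ suc s /2⌋ (m<n⇒0<n∸m h<t)))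
  where
  h<t : ⌊ suc t /2⌋ < t
  h<t = ⌊1+n/2⌋<n 2≤t
  h≤t = <⇒≤ h<t

double≤fib-upper-half : ∀ t → 20 ≤ suc t → 2 * suc t ≤ fib (suc (t ∸ ⌊ suc t /2⌋))
double≤fib-upper-half t 20≤j = begin
  2 * suc t                       ≤⟨ double≤fib-half (suc t) 20≤j ⟩
  fib ⌊ suc t /2⌋                 ≤⟨ fib-mono-≤ (⌊n/2⌋≤⌈n/2⌉ (suc t)) ⟩
  fib ⌈ suc t /2⌉                 ≡⟨ cong fib (n∸⌊n/2⌋≡⌈n/2⌉ (suc t)) ⟨
  fib (suc t ∸ ⌊ suc t /2⌋)       ≡⟨ cong fib (+-∸-assoc 1 (⌊1+n/2⌋≤n t)) ⟩
  fib (suc (t ∸ ⌊ suc t /2⌋))     ∎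
  where open ≤-Reasoning

halfBoundInR-large-j : ∀ s t → 20 ≤ suc t → HalfBoundInR s t
halfBoundInR-large-j zero t 20≤j = begin
  2 * suc t * coef 1 h              ≡⟨ cong (2 * suc t *_) (coef-one h) ⟩
  2 * suc t * fib (suc h)           ≤⟨ *-monoˡ-≤ (fib (suc h)) (double≤fib-upper-half t 20≤j) ⟩
  fib (suc (t ∸ h)) * fib (suc h)   ≤⟨ fib⁺-supermultiplicative (t ∸ h) h ⟩
  fib (suc (t ∸ h + h))             ≡⟨ cong (fib ∘ suc) (m∸n+n≡m (⌊1+n/2⌋≤n t)) ⟩
  fib (suc t)                       ≡⟨ coef-one t ⟨
  coef 1 t                          ∎
  where
  open ≤-Reasoning
  h = ⌊ suc t /2⌋
halfBoundInR-large-j (suc s) t 20≤j =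
  coef-split-bound ⌈ 2 + s /2⌉ ⌊ 2 + s /2⌋ h (t ∸ h) (2 * suc t)
    (⌈n/2⌉+⌊n/2⌋≡n (2 + s)) (m+[n∸m]≡n (⌊1+n/2⌋≤n t))
    (≤-trans (double≤fib-upper-half t 20≤j) (fib≤coef ⌊ 2 + s /2⌋ (t ∸ h) (s≤s z≤n)))
  where h = ⌊ suc t /2⌋

⌈1+n/2⌉≤n : ∀ {n} → 1 ≤ n → ⌈ suc n /2⌉ ≤ n
⌈1+n/2⌉≤n {suc n} _ = s≤s (⌊1+n/2⌋≤n n)

halfBoundInJ-large-r : ∀ s t → 2 * suc t ≤ ⌈ s /2⌉ → HalfBoundInJ s t
halfBoundInJ-large-r s t 2j≤h = ≤-trans
  (coef-split-bound ⌊ 2 + s /2⌋ ⌈ s /2⌉ k (2 + t ∸ k) (2 * suc t)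
     (cong suc (⌊n/2⌋+⌈n/2⌉≡n s)) (m+[n∸m]≡n (<⇒≤ k<2+t)) (≤-trans 2j≤h (r≤coef ⌈ s /2⌉ (m<n⇒0<n∸m k<2+t))))
  (m≤m+n _ _)
  where
  k = ⌈ suc t /2⌉
  k<2+t : k < 2 + t
  k<2+t = s≤s (⌈n/2⌉≤n (suc t))

halfBoundInJ-large-j : ∀ s t → 20 ≤ suc t → HalfBoundInJ s t
halfBoundInJ-large-j s t 20≤j = ≤-trans
  (coef-split-bound ⌊ 2 + s /2⌋ ⌈ 2 + s /2⌉ k (t ∸ k) (2 * suc t)
     (⌊n/2⌋+⌈n/2⌉≡n (2 + s)) (m+[n∸m]≡n k≤t) (≤-trans 2j≤fib (fib≤coef ⌈ 2 + s /2⌉ (t ∸ k) (s≤s z≤n))))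
  (m≤n+m _ _)
  where
  open ≤-Reasoning
  k = ⌈ suc t /2⌉
  k≤t : k ≤ t
  k≤t = ⌈1+n/2⌉≤n (≤-pred (≤-trans (s≤s (s≤s z≤n)) 20≤j))
  2j≤fib : 2 * suc t ≤ fib (suc (t ∸ k))
  2j≤fib = begin
    2 * suc t             ≤⟨ double≤fib-half (suc t) 20≤j ⟩
    fib ⌊ suc t /2⌋       ≡⟨ cong fib (n∸⌈n/2⌉≡⌊n/2⌋ (suc t)) ⟨
    fib (suc t ∸ k)       ≡⟨ cong fib (+-∸-assoc 1 k≤t) ⟩
    fib (suc (t ∸ k))     ∎

-- The small cases, by evaluation

_!_ : List ℕ → ℕ → ℕ
[] ! _ = 0
(x ∷ xs) ! zero = x
(x ∷ xs) ! suc i = xs ! i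

map-upTo-! : ∀ (f : ℕ → ℕ) {n i} → i < n → map f (upTo n) ! i ≡ f i
map-upTo-! f = map-applyUpTo-! id
  where
  map-applyUpTo-! : ∀ g {n i} → i < n → map f (applyUpTo g n) ! i ≡ f (g i)
  map-applyUpTo-! g {suc n} {zero} _ = refl
  map-applyUpTo-! g {suc n} {suc i} (s≤s i<n) = map-applyUpTo-! (λ k → g (suc k)) i<n

width : ℕ
width = 21

Represents : ℕ → List ℕ → Set
Represents r row = ∀ j → j < width → row ! j ≡ coef r j

convRow : List ℕ → List ℕ → List ℕ
convRow a b = map (λ j → sumTo j (λ i → a ! i * b ! (j ∸ i))) (upTo width)

convRow-represents : ∀ {a b} r → Represents 1 a → Represents r b → Represents (suc r) (convRow a b)
convRow-represents {a} {b} r rep-a rep-b j j<w =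
  trans (map-upTo-! (λ j → sumTo j (λ i → a ! i * b ! (j ∸ i))) j<w)
        (sumTo-cong j (λ i i≤j → cong₂ _*_ (trans (rep-a i (≤-<-trans i≤j j<w)) (coef-one i))
                                          (rep-b (j ∸ i) (≤-<-trans (m∸n≤m j i) j<w))))

rowAt : List (List ℕ) → ℕ → List ℕ
rowAt [] _ = []
rowAt (x ∷ xs) zero = x
rowAt (x ∷ xs) (suc r) = rowAt xs r

fibRow : List ℕ
fibRow = map (λ i → fib (suc i)) (upTo width)

-- Rows 0..77 and columns 0..20 contain every coefficient mentioned by GapInR r j and GapInJ r j for
-- r ≤ 76 and j ≤ 19, the cases that the analytic argument leaves open.
coefTable : List (List ℕ)
coefTable = iterate (convRow fibRow) (map (coef 0) (upTo width)) 78

coefTable-represents : ∀ {r} → r < 78 → Represents r (rowAt coefTable r)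
coefTable-represents {r} r<78 = subst (λ k → Represents k (rowAt coefTable r)) (+-identityʳ r)
  (iterate-represents r<78 (λ j j<w → map-upTo-! (coef 0) j<w))
  where
  fibRow-represents : Represents 1 fibRow
  fibRow-represents j j<w = trans (map-upTo-! (λ i → fib (suc i)) j<w) (sym (coef-one j))
  iterate-represents : ∀ {r n s x} → r < n → Represents s x →
                       Represents (r + s) (rowAt (iterate (convRow fibRow) x n) r)
  iterate-represents {zero} {suc n} _ rep = rep
  iterate-represents {suc r} {suc n} {s} {x} (s≤s r<n) rep j j<w =
    trans (iterate-represents r<n (convRow-represents {fibRow} {x} s fibRow-represents rep) j j<w)
          (cong (λ k → coef k j) (+-suc r s))

tableCoef : List (List ℕ) → ℕ → ℕ → ℕ
tableCoef t r j = rowAt t r ! j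

tableCoef-correct : ∀ {r j} → r < 78 → j < width → tableCoef coefTable r j ≡ coef r j
tableCoef-correct {r} {j} r<78 j<w = coefTable-represents r<78 j j<w

gapInROf-cong : ∀ {c c′ : ℕ → ℕ → ℕ} {r j} → (∀ {r′ j′} → r′ ≤ suc r → j′ ≤ suc j → c r′ j′ ≡ c′ r′ j′) →
                GapInROf c r j → GapInROf c′ r j
gapInROf-cong {r = r} {j} c≡c′ gap
  rewrite c≡c′ {r} {j} (n≤1+n r) (n≤1+n j)
        | c≡c′ {suc r} {j} ≤-refl (n≤1+n j)
        | c≡c′ {⌊ r /2⌋} {⌊ j /2⌋} (≤-trans (⌊n/2⌋≤n r) (n≤1+n r)) (≤-trans (⌊n/2⌋≤n j) (n≤1+n j))
        | c≡c′ {⌊ suc r /2⌋} {⌊ j /2⌋} (⌊n/2⌋≤n (suc r)) (≤-trans (⌊n/2⌋≤n j) (n≤1+n j)) = gap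

gapInJOf-cong : ∀ {c c′ : ℕ → ℕ → ℕ} {r j} → (∀ {r′ j′} → r′ ≤ suc r → j′ ≤ suc j → c r′ j′ ≡ c′ r′ j′) →
                GapInJOf c r j → GapInJOf c′ r j
gapInJOf-cong {r = r} {j} c≡c′ gap
  rewrite c≡c′ {r} {j} (n≤1+n r) (n≤1+n j)
        | c≡c′ {r} {suc j} (n≤1+n r) ≤-refl
        | c≡c′ {⌊ r /2⌋} {⌊ j /2⌋} (≤-trans (⌊n/2⌋≤n r) (n≤1+n r)) (≤-trans (⌊n/2⌋≤n j) (n≤1+n j))
        | c≡c′ {⌊ r /2⌋} {⌊ suc j /2⌋} (≤-trans (⌊n/2⌋≤n r) (n≤1+n r)) (⌊n/2⌋≤n (suc j)) = gap

allIn : ℕ → ℕ → (ℕ → Bool) → Bool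
allIn lo n p = all p (applyUpTo (_+_ lo) n)

allIn-sound : ∀ lo n (p : ℕ → Bool) → T (allIn lo n p) → ∀ {i} → lo ≤ i → i < lo + n → T (p i)
allIn-sound lo n p holds {i} lo≤i i<lo+n = subst (T ∘ p) (m+[n∸m]≡n lo≤i)
  (applyUpTo⁻ (_+_ lo) n (all⁺ p (applyUpTo (_+_ lo) n) holds)
              (subst (i ∸ lo <_) (m+n∸m≡n lo n) (∸-monoˡ-< i<lo+n lo≤i)))

gapInROf? : ∀ c r j → Dec (GapInROf c r j)
gapInROf? c r j = _ <? _

gapInJOf? : ∀ c r j → Dec (GapInJOf c r j)
gapInJOf? c r j = _ <? _

-- The table is an argument, not a global constant, so that it is evaluated only once.
smallGapsInJ smallGapsInR smallGapsAt : List (List ℕ) → ℕ → Bool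
smallGapsInJ t r = allIn 1 19 (λ j → isYes (gapInJOf? (tableCoef t) r j))
smallGapsInR t r = allIn 3 17 (λ j → isYes (gapInROf? (tableCoef t) r j))
smallGapsAt t r = smallGapsInJ t r ∧ smallGapsInR t r

smallGaps-coefTable : T (allIn 1 76 (smallGapsAt coefTable))
smallGaps-coefTable = tt

module _ {r} (1≤r : 1 ≤ r) (r≤76 : r ≤ 76) where

  private
    smallGapsAt-r : T (smallGapsInJ coefTable r) × T (smallGapsInR coefTable r)
    smallGapsAt-r = Equivalence.to (T-∧ {smallGapsInJ coefTable r} {smallGapsInR coefTable r})
      (allIn-sound 1 76 (smallGapsAt coefTable) smallGaps-coefTable 1≤r (s≤s r≤76))

    tableCoef≡coef : ∀ {j r′ j′} → j ≤ 19 → r′ ≤ suc r → j′ ≤ suc j → tableCoef coefTable r′ j′ ≡ coef r′ j′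
    tableCoef≡coef j≤19 r′≤ j′≤ =
      tableCoef-correct (≤-trans (s≤s r′≤) (s≤s (s≤s r≤76))) (s≤s (≤-trans j′≤ (s≤s j≤19)))

  gapInJ-small : ∀ {j} → 1 ≤ j → j ≤ 19 → GapInJ r j
  gapInJ-small {j} 1≤j j≤19 = gapInJOf-cong {tableCoef coefTable} {coef} {r} {j} (tableCoef≡coef j≤19)
    (toWitness {a? = gapInJOf? (tableCoef coefTable) r j}
      (allIn-sound 1 19 (λ j → isYes (gapInJOf? (tableCoef coefTable) r j)) (proj₁ smallGapsAt-r) 1≤j (s≤s j≤19)))

  gapInR-small : ∀ {j} → 3 ≤ j → j ≤ 19 → GapInR r j
  gapInR-small {j} 3≤j j≤19 = gapInROf-cong {tableCoef coefTable} {coef} {r} {j} (tableCoef≡coef j≤19)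
    (toWitness {a? = gapInROf? (tableCoef coefTable) r j}
      (allIn-sound 3 17 (λ j → isYes (gapInROf? (tableCoef coefTable) r j)) (proj₂ smallGapsAt-r) 3≤j (s≤s j≤19)))

errorBound-one : ∀ j → errorBound 1 j ≡ 0
errorBound-one zero = refl
errorBound-one (suc zero) = refl
errorBound-one (suc (suc j)) = *-zeroʳ (suc j)

gapInJ-one : ∀ t → GapInJ 1 (suc t)
gapInJ-one t = begin-strict
  coef 1 (suc t) + errorBound 1 (suc t) + errorBound 1 (2 + t)
    ≡⟨ cong₂ (λ x y → coef 1 (suc t) + x + y) (errorBound-one (suc t)) (errorBound-one (2 + t)) ⟩
  coef 1 (suc t) + 0 + 0          ≡⟨ trans (+-identityʳ _) (+-identityʳ _) ⟩
  coef 1 (suc t)                  ≡⟨ coef-one (suc t) ⟩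
  fib (2 + t)                     <⟨ m<n+m (fib (2 + t)) (fib-mono-≤ {1} {suc t} (s≤s z≤n)) ⟩
  fib (1 + t) + fib (2 + t)       ≡⟨ coef-one (2 + t) ⟨
  coef 1 (2 + t)                  ∎
  where open ≤-Reasoning

n≤⌈n/2⌉+⌈n/2⌉ : ∀ n → n ≤ ⌈ n /2⌉ + ⌈ n /2⌉
n≤⌈n/2⌉+⌈n/2⌉ n = subst (_≤ ⌈ n /2⌉ + ⌈ n /2⌉) (⌊n/2⌋+⌈n/2⌉≡n n) (+-monoˡ-≤ ⌈ n /2⌉ (⌊n/2⌋≤⌈n/2⌉ n))

gapInR : ∀ r j → 1 ≤ r → 3 ≤ j → GapInR r j
gapInR (suc s) (suc t) _ (s≤s 2≤t) with 2 * suc t ≤? ⌊ suc s /2⌋ | 20 ≤? suc t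
... | yes large-r | _ = gapInR-from-halfBound s t 2≤t (halfBoundInR-large-r s t 2≤t large-r)
... | no _ | yes large-j = gapInR-from-halfBound s t 2≤t (halfBoundInR-large-j s t large-j)
... | no small-r | no small-j = gapInR-small (s≤s z≤n) r≤76 (s≤s 2≤t) j≤19
  where
  j≤19 : suc t ≤ 19
  j≤19 = ≤-pred (≰⇒> small-j)
  h≤37 : ⌊ suc s /2⌋ ≤ 37
  h≤37 = ≤-pred (≤-trans (≰⇒> small-r) (*-monoʳ-≤ 2 j≤19))
  r≤76 : suc s ≤ 76
  r≤76 = ≤-trans (n≤⌊n/2⌋+1+⌊n/2⌋ (suc s)) (≤-trans (+-mono-≤ h≤37 (s≤s h≤37)) (n≤1+n 75))

gapInJ : ∀ r j → 1 ≤ r → 1 ≤ j → GapInJ r j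
gapInJ (suc zero) (suc t) _ _ = gapInJ-one t
gapInJ (suc (suc s)) (suc t) _ _ with 2 * suc t ≤? ⌈ s /2⌉ | 20 ≤? suc t
... | yes large-r | _ = gapInJ-from-halfBound s t (halfBoundInJ-large-r s t large-r)
... | no _ | yes large-j = gapInJ-from-halfBound s t (halfBoundInJ-large-j s t large-j)
... | no small-r | no small-j = gapInJ-small (s≤s z≤n) r≤76 (s≤s z≤n) j≤19
  where
  j≤19 : suc t ≤ 19
  j≤19 = ≤-pred (≰⇒> small-j)
  h≤37 : ⌈ s /2⌉ ≤ 37
  h≤37 = ≤-pred (≤-trans (≰⇒> small-r) (*-monoʳ-≤ 2 j≤19))
  r≤76 : suc (suc s) ≤ 76
  r≤76 = s≤s (s≤s (≤-trans (n≤⌈n/2⌉+⌈n/2⌉ s) (+-mono-≤ h≤37 h≤37)))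

-- The numerators as divisor sums

infix 4 _≈_±_

_≈_±_ : ℤ → ℤ → ℕ → Set
N ≈ c ± B = Σ[ R ∈ ℤ ] ∣ R ∣ ≤ B × N ≡ c ℤ.+ R

∣sum∣≤length*bound : ∀ {u} (xs : List ℤ) → All (λ x → ∣ x ∣ ≤ u) xs → ∣ foldr ℤ._+_ 0ℤ xs ∣ ≤ length xs * u
∣sum∣≤length*bound [] [] = z≤n
∣sum∣≤length*bound (x ∷ xs) (x≤u ∷ xs≤u) =
  ≤-trans (ℤ.∣i+j∣≤∣i∣+∣j∣ x _) (+-mono-≤ x≤u (∣sum∣≤length*bound xs xs≤u))

≈-weaken : ∀ {N c B B′} → B ≤ B′ → N ≈ c ± B → N ≈ c ± B′
≈-weaken B≤B′ (R , R≤B , N≡c+R) = R , ≤-trans R≤B B≤B′ , N≡c+R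

divSum-≈ : ∀ m (f : (d : ℕ) → .{{NonZero d}} → ℤ) u → 1 ≤ m →
  (∀ d .{{_ : NonZero d}} → 2 ≤ d → d ≤ m → ∣ f d ∣ ≤ u) → divSum m f ≈ f 1 ± (m ∸ 1) * u
divSum-≈ (suc m) f u _ f≤u = foldr ℤ._+_ 0ℤ others , others≤ , cong (ℤ._+ foldr ℤ._+_ 0ℤ others) leading
  where
  term : ℕ → ℤ
  term k = if ⌊ suc k ∣? suc m ⌋ then f (suc k) else 0ℤ
  others = map term (applyUpTo suc m)
  leading : term 0 ≡ f 1
  leading rewrite isYes≗does (1 ∣? suc m) | dec-true (1 ∣? suc m) (1∣ suc m) = refl
  term≤u : ∀ {k} → k < m → ∣ term (suc k) ∣ ≤ u
  term≤u {k} k<m with ⌊ 2 + k ∣? suc m ⌋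
  ... | true = f≤u (2 + k) (s≤s (s≤s z≤n)) (s≤s k<m)
  ... | false = z≤n
  others≤ : ∣ foldr ℤ._+_ 0ℤ others ∣ ≤ m * u
  others≤ = subst (λ n → ∣ foldr ℤ._+_ 0ℤ others ∣ ≤ n * u)
                  (trans (length-map term (applyUpTo suc m)) (length-applyUpTo suc m))
                  (∣sum∣≤length*bound others (map⁺ (applyUpTo⁺₁ suc m term≤u)))

n/2≡⌊n/2⌋ : ∀ n → n / 2 ≡ ⌊ n /2⌋
n/2≡⌊n/2⌋ zero = refl
n/2≡⌊n/2⌋ (suc zero) = refl
n/2≡⌊n/2⌋ (suc (suc n)) = trans (m/n≡1+[m∸n]/n {2 + n} {2} (s≤s (s≤s z≤n))) (cong suc (n/2≡⌊n/2⌋ n))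

coef-quotient-bound : ∀ r j d .{{_ : NonZero d}} → 2 ≤ d → d ≤ r →
  coef (r / d) (j / d) ≤ coef ⌊ r /2⌋ ⌊ j /2⌋
coef-quotient-bound r j d 2≤d d≤r = begin
  coef (r / d) (j / d)      ≤⟨ coef-monoˡ-≤ (j / d) (≤-trans (/-monoʳ-≤ r 2≤d) (≤-reflexive (n/2≡⌊n/2⌋ r))) ⟩
  coef ⌊ r /2⌋ (j / d)      ≤⟨ monoʳ (⌊n/2⌋-mono (≤-trans 2≤d d≤r))
                                     (≤-trans (/-monoʳ-≤ j 2≤d) (≤-reflexive (n/2≡⌊n/2⌋ j))) ⟩
  coef ⌊ r /2⌋ ⌊ j /2⌋      ∎
  where
  open ≤-Reasoning
  monoʳ : ∀ {a k k′} → 1 ≤ a → k ≤ k′ → coef a k ≤ coef a k′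
  monoʳ {suc a} _ = coef-monoʳ-≤ a

∣-1^k∣≡1 : ∀ k → ∣ -1ℤ ℤ.^ k ∣ ≡ 1
∣-1^k∣≡1 zero = refl
∣-1^k∣≡1 (suc k) = trans (ℤ.abs-* -1ℤ (-1ℤ ℤ.^ k)) (cong (1 *_) (∣-1^k∣≡1 k))

∣-1^k*x∣≡∣x∣ : ∀ k x → ∣ (-1ℤ ℤ.^ k) ℤ.* x ∣ ≡ ∣ x ∣
∣-1^k*x∣≡∣x∣ k x = trans (ℤ.abs-* (-1ℤ ℤ.^ k) x) (trans (cong (_* ∣ x ∣) (∣-1^k∣≡1 k)) (*-identityˡ ∣ x ∣))

∣μ*x∣≤∣x∣ : ∀ n x → ∣ μ n ℤ.* x ∣ ≤ ∣ x ∣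
∣μ*x∣≤∣x∣ n x rewrite ℤ.abs-* (μ n) x = subst (∣ μ n ∣ * ∣ x ∣ ≤_) (*-identityˡ ∣ x ∣) (*-monoˡ-≤ ∣ x ∣ ∣μ∣≤1)
  where
  ∣μ∣≤1 : ∣ μ n ∣ ≤ 1
  ∣μ∣≤1 with hasSquareFactor n
  ... | true = z≤n
  ... | false = ≤-reflexive (∣-1^k∣≡1 (ω n))

F-coef : ∀ r j → F r (j + 1) ≡ coef r j
F-coef r j = cong (coef r) (m+n∸n≡m j 1)

gcdSum-≈ : ∀ r j → 1 ≤ r → 1 ≤ j → (f : (d : ℕ) → .{{NonZero d}} → ℤ) →
  (∀ d .{{_ : NonZero d}} → ∣ f d ∣ ≤ coef (r / d) (j / d)) → divSum (gcd r j) f ≈ f 1 ± errorBound r j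
gcdSum-≈ r@(suc _) j@(suc _) _ _ f f≤ =
  ≈-weaken {divSum (gcd r j) f} {f 1} (*-monoˡ-≤ (coef ⌊ r /2⌋ ⌊ j /2⌋) (∸-monoˡ-≤ 1 g≤j))
  (divSum-≈ (gcd r j) f (coef ⌊ r /2⌋ ⌊ j /2⌋) 1≤g
    (λ d 2≤d d≤g → ≤-trans (f≤ d) (coef-quotient-bound r j d 2≤d (≤-trans d≤g g≤r))))
  where
  g≤r = ∣⇒≤ (gcd[m,n]∣m r j)
  g≤j = ∣⇒≤ (gcd[m,n]∣n r j)
  1≤g = n≢0⇒n>0 (gcd[m,n]≢0 r j (inj₁ (λ ())))

-1^k*-1^k*x≡x : ∀ k x → (-1ℤ ℤ.^ k) ℤ.* ((-1ℤ ℤ.^ k) ℤ.* x) ≡ x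
-1^k*-1^k*x≡x zero x = trans (ℤ.*-identityˡ _) (ℤ.*-identityˡ x)
-1^k*-1^k*x≡x (suc k) x = trans (swap-signs (-1ℤ ℤ.^ k) x) (-1^k*-1^k*x≡x k x)
  where
  swap-signs : ∀ p x → (-1ℤ ℤ.* p) ℤ.* ((-1ℤ ℤ.* p) ℤ.* x) ≡ p ℤ.* (p ℤ.* x)
  swap-signs = ℤ-Solver.solve-∀

≈-*-sign : ∀ {N c B} k → N ≈ c ± B → (-1ℤ ℤ.^ k) ℤ.* N ≈ (-1ℤ ℤ.^ k) ℤ.* c ± B
≈-*-sign {c = c} k (R , R≤B , refl) =
  (-1ℤ ℤ.^ k) ℤ.* R , ≤-trans (≤-reflexive (∣-1^k*x∣≡∣x∣ k R)) R≤B , ℤ.*-distribˡ-+ (-1ℤ ℤ.^ k) c R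

-- G (suc r) (suc j) unfolds to numeratorG (suc r) j / suc r, and H (suc r) (suc j) to
-- (-1)^(suc r) · numeratorH (suc r) j / suc r.
termG termH : ℕ → ℕ → (d : ℕ) → .{{NonZero d}} → ℤ
termG r j d = μ d ℤ.* + F (r / d) (j / d + 1)
termH r j d = μ d ℤ.* ((-1ℤ ℤ.^ (r / d)) ℤ.* + F (r / d) (j / d + 1))

numeratorG numeratorH : ℕ → ℕ → ℤ
numeratorG r j = divSum (gcd r j) (termG r j)
numeratorH r j = divSum (gcd r j) (termH r j)

numeratorG-≈ : ∀ r j → 1 ≤ r → 1 ≤ j → numeratorG r j ≈ + coef r j ± errorBound r j
numeratorG-≈ r j 1≤r 1≤j = subst (λ c → numeratorG r j ≈ c ± errorBound r j) leading
  (gcdSum-≈ r j 1≤r 1≤j (termG r j) (λ d → ≤-trans (∣μ*x∣≤∣x∣ d _) (≤-reflexive (F-coef (r / d) (j / d)))))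
  where
  leading : termG r j 1 ≡ + coef r j
  leading = trans (ℤ.*-identityˡ _)
    (cong +_ (trans (cong₂ (λ a b → F a (b + 1)) (n/1≡n r) (n/1≡n j)) (F-coef r j)))

signed-numeratorH-≈ : ∀ r j → 1 ≤ r → 1 ≤ j → (-1ℤ ℤ.^ r) ℤ.* numeratorH r j ≈ + coef r j ± errorBound r j
signed-numeratorH-≈ r j 1≤r 1≤j =
  subst (λ c → (-1ℤ ℤ.^ r) ℤ.* numeratorH r j ≈ c ± errorBound r j) (-1^k*-1^k*x≡x r (+ coef r j))
    (≈-*-sign r (subst (λ c → numeratorH r j ≈ c ± errorBound r j) leading
      (gcdSum-≈ r j 1≤r 1≤j (termH r j) (λ d → ≤-trans (∣μ*x∣≤∣x∣ d _)
        (≤-reflexive (trans (∣-1^k*x∣≡∣x∣ (r / d) _) (F-coef (r / d) (j / d))))))))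
  where
  leading : termH r j 1 ≡ (-1ℤ ℤ.^ r) ℤ.* + coef r j
  leading = trans (ℤ.*-identityˡ _)
    (trans (cong₂ (λ a b → (-1ℤ ℤ.^ a) ℤ.* + F a (b + 1)) (n/1≡n r) (n/1≡n j))
           (cong (λ x → (-1ℤ ℤ.^ r) ℤ.* + x) (F-coef r j)))

-- Comparing the quotients

*<*⇒/< : ∀ (X Y : ℤ) r r′ → X ℤ.* + suc r′ ℤ.< Y ℤ.* + suc r → X ℚ./ suc r ℚ.< Y ℚ./ suc r′
*<*⇒/< X Y r r′ X*r′<Y*r = ℚ.toℚᵘ-cancel-<
  (ℚᵘ.<-respˡ-≃ (ℚᵘ.≃-sym (ℚ.toℚᵘ-fromℚᵘ (ℚᵘ.mkℚᵘ X r)))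
    (ℚᵘ.<-respʳ-≃ (ℚᵘ.≃-sym (ℚ.toℚᵘ-fromℚᵘ (ℚᵘ.mkℚᵘ Y r′))) (ℚᵘ.*<* X*r′<Y*r)))

i≤+∣i∣ : ∀ R → R ℤ.≤ + ∣ R ∣
i≤+∣i∣ (+ n) = ℤ.≤-refl
i≤+∣i∣ -[1+ n ] = -≤+

≈-upper : ∀ {N c B} → N ≈ + c ± B → N ℤ.≤ + (c + B)
≈-upper {c = c} {B} (R , R≤B , refl) =
  ℤ.≤-trans (ℤ.+-monoʳ-≤ (+ c) (ℤ.≤-trans (i≤+∣i∣ R) (+≤+ R≤B))) (ℤ.≤-reflexive (sym (ℤ.pos-+ c B)))

≈-lower : ∀ {N c B} → N ≈ + c ± B → + c ℤ.≤ N ℤ.+ + B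
≈-lower {c = c} {B} (R , R≤B , refl) = ℤ.≤-trans (ℤ.≤-reflexive (c≡c+R-R (+ c) R))
  (ℤ.+-monoʳ-≤ (+ c ℤ.+ R) (ℤ.≤-trans (i≤+∣i∣ (ℤ.- R)) (+≤+ (≤-trans (≤-reflexive (ℤ.∣-i∣≡∣i∣ R)) R≤B))))
  where
  c≡c+R-R : ∀ c R → c ≡ c ℤ.+ R ℤ.+ ℤ.- R
  c≡c+R-R = ℤ-Solver.solve-∀

≈-quotient-< : ∀ {N N′ c c′ B B′} r r′ → N ≈ + c ± B → N′ ≈ + c′ ± B′ →
  suc r′ * (c + B) + suc r * B′ < suc r * c′ → N ℚ./ suc r ℚ.< N′ ℚ./ suc r′
≈-quotient-< {N} {N′} {c} {c′} {B} {B′} r r′ N≈ N′≈ gap = *<*⇒/< N N′ r r′ (cancel (begin-strict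
  N ℤ.* + suc r′ ℤ.+ K
    ≤⟨ ℤ.+-monoˡ-≤ K (ℤ.*-monoʳ-≤-nonNeg (+ suc r′) (≈-upper N≈)) ⟩
  + (c + B) ℤ.* + suc r′ ℤ.+ K
    ≡⟨ cong₂ ℤ._+_ (sym (ℤ.pos-* (c + B) (suc r′))) (sym (ℤ.pos-* B′ (suc r))) ⟩
  + ((c + B) * suc r′) ℤ.+ + (B′ * suc r)
    ≡⟨ sym (ℤ.pos-+ ((c + B) * suc r′) (B′ * suc r)) ⟩
  + ((c + B) * suc r′ + B′ * suc r)
    ≡⟨ cong +_ (cong₂ _+_ (*-comm (c + B) (suc r′)) (*-comm B′ (suc r))) ⟩
  + (suc r′ * (c + B) + suc r * B′)
    <⟨ ℤ.+<+ gap ⟩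
  + (suc r * c′)
    ≡⟨ trans (cong +_ (*-comm (suc r) c′)) (ℤ.pos-* c′ (suc r)) ⟩
  + c′ ℤ.* + suc r
    ≤⟨ ℤ.*-monoʳ-≤-nonNeg (+ suc r) (≈-lower N′≈) ⟩
  (N′ ℤ.+ + B′) ℤ.* + suc r
    ≡⟨ ℤ.*-distribʳ-+ (+ suc r) N′ (+ B′) ⟩
  N′ ℤ.* + suc r ℤ.+ K ∎))
  where
  open ℤ.≤-Reasoning
  K = + B′ ℤ.* + suc r
  cancel : ∀ {x y} → x ℤ.+ K ℤ.< y ℤ.+ K → x ℤ.< y
  cancel {x} {y} x+K<y+K =
    subst₂ ℤ._<_ (x+K-K≡x x K) (x+K-K≡x y K) (ℤ.+-monoˡ-< (ℤ.- K) x+K<y+K)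
    where
    x+K-K≡x : ∀ x K → x ℤ.+ K ℤ.+ ℤ.- K ≡ x
    x+K-K≡x = ℤ-Solver.solve-∀

gapInJ-scaled : ∀ s j → 1 ≤ j →
  suc s * (coef (suc s) j + errorBound (suc s) j) + suc s * errorBound (suc s) (suc j)
    < suc s * coef (suc s) (suc j)
gapInJ-scaled s j 1≤j = subst (_< suc s * coef (suc s) (suc j))
  (*-distribˡ-+ (suc s) (coef (suc s) j + errorBound (suc s) j) (errorBound (suc s) (suc j)))
  (*-monoʳ-< (suc s) (gapInJ (suc s) j (s≤s z≤n) 1≤j))

theorem7 : ((j : ℕ) → j ≥ 4 → (r : ℕ) → r ≥ 1 → G r j ℚ.< G (suc r) j)
    × ((r : ℕ) → r ≥ 1 → (j : ℕ) → j ≥ 2 → G r j ℚ.< G r (suc j))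
    × ((j : ℕ) → j ≥ 4 → (r : ℕ) → r ≥ 1 → H r j ℚ.< H (suc r) j)
    × ((r : ℕ) → r ≥ 1 → (j : ℕ) → j ≥ 2 → H r j ℚ.< H r (suc j))
theorem7 = G-increasing-in-r , G-increasing-in-j , H-increasing-in-r , H-increasing-in-j
  where
  G-increasing-in-r : (j : ℕ) → j ≥ 4 → (r : ℕ) → r ≥ 1 → G r j ℚ.< G (suc r) j
  G-increasing-in-r (suc j) (s≤s 3≤j) (suc s) 1≤r = ≈-quotient-< s (suc s)
    (numeratorG-≈ (suc s) j 1≤r 1≤j) (numeratorG-≈ (2 + s) j (s≤s z≤n) 1≤j) (gapInR (suc s) j 1≤r 3≤j)
    where 1≤j = ≤-trans (s≤s z≤n) 3≤j
  G-increasing-in-j : (r : ℕ) → r ≥ 1 → (j : ℕ) → j ≥ 2 → G r j ℚ.< G r (suc j)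
  G-increasing-in-j (suc s) 1≤r (suc j) (s≤s 1≤j) = ≈-quotient-< s s
    (numeratorG-≈ (suc s) j 1≤r 1≤j) (numeratorG-≈ (suc s) (suc j) 1≤r (s≤s z≤n)) (gapInJ-scaled s j 1≤j)
  H-increasing-in-r : (j : ℕ) → j ≥ 4 → (r : ℕ) → r ≥ 1 → H r j ℚ.< H (suc r) j
  H-increasing-in-r (suc j) (s≤s 3≤j) (suc s) 1≤r = ≈-quotient-< s (suc s)
    (signed-numeratorH-≈ (suc s) j 1≤r 1≤j) (signed-numeratorH-≈ (2 + s) j (s≤s z≤n) 1≤j) (gapInR (suc s) j 1≤r 3≤j)
    where 1≤j = ≤-trans (s≤s z≤n) 3≤j
  H-increasing-in-j : (r : ℕ) → r ≥ 1 → (j : ℕ) → j ≥ 2 → H r j ℚ.< H r (suc j)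
  H-increasing-in-j (suc s) 1≤r (suc j) (s≤s 1≤j) = ≈-quotient-< s s
    (signed-numeratorH-≈ (suc s) j 1≤r 1≤j) (signed-numeratorH-≈ (suc s) (suc j) 1≤r (s≤s z≤n)) (gapInJ-scaled s j 1≤j)
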